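{- Let $k$ be a positive integer. Then there do not exist $\frac{k(k+1)}{2}$ consecutive nonnegative integers $n$ for which $p(n,k)$ is even; that is, any run of consecutive nonnegative integers $n$ with $p(n,k)$ even has length at most $\frac{k(k+1)}{2}-1$.
   Context: For a nonnegative integer $n$ and a positive integer $k$, $p(n,k)$ denotes the number of partitions of $n$ into parts each less than or equal to $k$ (so $p(0,k)=1$); equivalently, $\sum_{n\ge 0} p(n,k)q^n = \prod_{i=1}^{k} \frac{1}{1-q^i}$. -}

module Defs where

open import Data.Nat using (ℕ; zero; suc; _+_; _*_; _≡ᵇ_)
open import Data.List using (List; []; _∷_; length; filter; map; concatMap; upTo)
open import Data.Bool using (Bool; true; false; T)
open import Data.Nat.Properties using (_≟_)
open import Relation.Nullary.Decidable using (⌊_⌋)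

-- A partition of n into parts each ≤ k is determined by its multiplicity
-- vector (m₁, …, m_k), mᵢ = number of parts equal to i, with Σ i·mᵢ = n.
-- MultVecs n j : all lists [m₁, …, m_j] with each mᵢ ≤ n (any partition of n
-- has every multiplicity ≤ n, so this enumeration is exhaustive).
MultVecs : ℕ → ℕ → List (List ℕ)
MultVecs n zero    = [] ∷ []
MultVecs n (suc j) = concatMap (λ v → map (λ m → v Data.List.++ (m ∷ [])) (upTo (suc n))) (MultVecs n j)

weightFrom : ℕ → List ℕ → ℕ
weightFrom i []       = 0
weightFrom i (m ∷ ms) = i * m + weightFrom (suc i) ms

weight : List ℕ → ℕ
weight = weightFrom 1

p : ℕ → ℕ → ℕ
p n k = length (filter (λ v → weight v ≟ n) (MultVecs n k))

module Submission where

-- Write K = k + 1.  Splitting off the multiplicity of the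
-- largest allowed part gives the classical recurrence
--     p(K + n, K) = p(K + n, k) + p(n, K),
-- i.e. partitions of K + n with parts ≤ K either avoid the part K or arise
-- from a partition of n by adding one part K.  Hence if p(·, K) is even on
-- a run s, …, s + K + L - 1, then p(·, k) is even on the run
-- s + K, …, s + K + L - 1 of length L.  Since T(K) = K(K+1)/2 satisfies
-- T(K) = K + T(k), a run of length T(K) for K would descend to a run of
-- length T(1) = 1 for parts ≤ 1; but p(n, 1) = 1 is odd.

open import Defs
open import Data.Nat using (ℕ; suc; _+_; _*_; _/_; _<_)
open import Data.Nat.Divisibility using (_∣_)
open import Data.Product using (∃-syntax)
open import Relation.Nullary using (¬_)

open import Data.Nat using (zero; _≤_; _≡ᵇ_; z≤n; s≤s)
open import Data.Nat.Properties
  using (_≟_; +-comm; +-assoc; +-suc; +-identityʳ; *-zeroʳ; ≤-trans;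
         m≤m+n; m≤n+m; +-monoʳ-<; <-≤-trans; +-commutativeSemigroup)
open import Data.Nat.Divisibility using (divides; ∣m+n∣m⇒∣n)
open import Data.Nat.DivMod using (+-distrib-/-∣ˡ; m*n/n≡m)
open import Data.Nat.ListAction using (sum)
open import Data.Nat.ListAction.Properties using (sum-++)
open import Data.Nat.Tactic.RingSolver using (solve-∀)
open import Data.List using (List; []; _∷_; _++_; map; length; filter; concatMap; upTo; applyUpTo)
open import Data.List.Properties using (map-++; map-applyUpTo; map-cong; map-cong-local; length-++)
open import Data.List.Relation.Unary.All as All using (All; []; _∷_)
open import Data.List.Relation.Unary.All.Properties using (concat⁺; map⁺; applyUpTo⁺₂)
open import Data.Product using (_,_)
open import Data.Bool using (true; false; if_then_else_)
open import Relation.Binary.PropositionalEquality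
open import Function using (_∘_; id)
open import Algebra.Properties.CommutativeSemigroup +-commutativeSemigroup using (interchange)

-- δ n w : the indicator of w ≡ n.  It is written with _≡ᵇ_, which is what
-- the decision procedure in the filter defining p computes.
δ : ℕ → ℕ → ℕ
δ n w = if w ≡ᵇ n then 1 else 0

δ-shift : ∀ a n w → δ (a + n) (a + w) ≡ δ n w
δ-shift zero    n w = refl
δ-shift (suc a) n w = δ-shift a n w

δ-above : ∀ n w → n < w → δ n w ≡ 0
δ-above zero    (suc w) _         = refl
δ-above (suc n) (suc w) (s≤s n<w) = δ-above n w n<w

Σ< : (ℕ → ℕ) → ℕ → ℕ
Σ< φ B = sum (applyUpTo φ B)

Σ<-cong : ∀ {φ ψ} B → (∀ m → φ m ≡ ψ m) → Σ< φ B ≡ Σ< ψ B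
Σ<-cong {φ} {ψ} B φ≗ψ = cong sum (begin
  applyUpTo φ B           ≡⟨ sym (map-applyUpTo id φ B) ⟩
  map φ (upTo B)          ≡⟨ map-cong φ≗ψ (upTo B) ⟩
  map ψ (upTo B)          ≡⟨ map-applyUpTo id ψ B ⟩
  applyUpTo ψ B           ∎)
  where open ≡-Reasoning

Σ<-zero : ∀ φ B → (∀ m → φ m ≡ 0) → Σ< φ B ≡ 0
Σ<-zero φ zero    φ≡0 = refl
Σ<-zero φ (suc B) φ≡0 = cong₂ _+_ (φ≡0 0) (Σ<-zero (φ ∘ suc) B (φ≡0 ∘ suc))

Σ<-truncate : ∀ φ c B → (∀ m → c ≤ m → φ m ≡ 0) → c ≤ B → Σ< φ B ≡ Σ< φ c
Σ<-truncate φ zero    B       φ≡0 _         = Σ<-zero φ B (λ m → φ≡0 m z≤n)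
Σ<-truncate φ (suc c) (suc B) φ≡0 (s≤s c≤B) =
  cong (φ 0 +_) (Σ<-truncate (φ ∘ suc) c B (λ m c≤m → φ≡0 (suc m) (s≤s c≤m)) c≤B)

-- Σ-prog g K w B = g w + g (w + K) + ⋯ + g (w + (B-1) K): the sum of g along
-- an arithmetic progression, which is what choosing the multiplicity of
-- the part K contributes.
Σ-prog : (ℕ → ℕ) → ℕ → ℕ → ℕ → ℕ
Σ-prog g K w B = Σ< (λ m → g (w + K * m)) B

module _ {g : ℕ → ℕ} {n : ℕ} (g-above : ∀ w → n < w → g w ≡ 0) (k : ℕ) where

  Σ-prog-above : ∀ B w → n < w → Σ-prog g (suc k) w B ≡ 0
  Σ-prog-above B w n<w =
    Σ<-zero _ B (λ m → g-above _ (≤-trans n<w (m≤m+n w (suc k * m))))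

  Σ-prog-truncate : ∀ w B → n ≤ B → Σ-prog g (suc k) w (suc B) ≡ Σ-prog g (suc k) w (suc n)
  Σ-prog-truncate w B n≤B = Σ<-truncate _ (suc n) (suc B) tail-vanishes (s≤s n≤B)
    where
    tail-vanishes : ∀ m → suc n ≤ m → g (w + suc k * m) ≡ 0
    tail-vanishes m n<m =
      g-above _ (≤-trans n<m (≤-trans (m≤m+n m (k * m)) (m≤n+m (suc k * m) w)))

sum-concatMap : ∀ {A B : Set} (G : B → ℕ) (F : A → List B) (xs : List A) →
  sum (map G (concatMap F xs)) ≡ sum (map (sum ∘ map G ∘ F) xs)
sum-concatMap G F []       = refl
sum-concatMap G F (x ∷ xs) = begin
  sum (map G (F x ++ concatMap F xs))              ≡⟨ cong sum (map-++ G (F x) _) ⟩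
  sum (map G (F x) ++ map G (concatMap F xs))      ≡⟨ sum-++ (map G (F x)) _ ⟩
  sum (map G (F x)) + sum (map G (concatMap F xs)) ≡⟨ cong (sum (map G (F x)) +_) (sum-concatMap G F xs) ⟩
  sum (map G (F x)) + sum (map (sum ∘ map G ∘ F) xs) ∎
  where open ≡-Reasoning

sum-map-+ : ∀ {A : Set} (f g : A → ℕ) (xs : List A) →
  sum (map (λ x → f x + g x) xs) ≡ sum (map f xs) + sum (map g xs)
sum-map-+ f g []       = refl
sum-map-+ f g (x ∷ xs) = begin
  f x + g x + sum (map (λ x → f x + g x) xs)      ≡⟨ cong (f x + g x +_) (sum-map-+ f g xs) ⟩
  f x + g x + (sum (map f xs) + sum (map g xs))   ≡⟨ interchange (f x) (g x) _ _ ⟩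
  f x + sum (map f xs) + (g x + sum (map g xs))   ∎
  where open ≡-Reasoning

Tally : ℕ → ℕ → (ℕ → ℕ) → ℕ
Tally B k g = sum (map (g ∘ weight) (MultVecs B k))

Tally-cong : ∀ B k {f g} → (∀ w → f w ≡ g w) → Tally B k f ≡ Tally B k g
Tally-cong B k f≗g = cong sum (map-cong (f≗g ∘ weight) (MultVecs B k))

length-filter-weight : ∀ n (vs : List (List ℕ)) →
  length (filter (λ v → weight v ≟ n) vs) ≡ sum (map (δ n ∘ weight) vs)
length-filter-weight n []       = refl
length-filter-weight n (v ∷ vs) with weight v ≡ᵇ n
... | true  = cong suc (length-filter-weight n vs)
... | false = length-filter-weight n vs

p≡Tally : ∀ n k → p n k ≡ Tally n k (δ n)
p≡Tally n k = length-filter-weight n (MultVecs n k)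

MultVecs-length : ∀ B k → All (λ v → length v ≡ k) (MultVecs B k)
MultVecs-length B zero    = refl ∷ []
MultVecs-length B (suc k) =
  concat⁺ (map⁺ (All.map extend (MultVecs-length B k)))
  where
  extend : ∀ {v} → length v ≡ k → All (λ u → length u ≡ suc k) (map (λ m → v ++ (m ∷ [])) (upTo (suc B)))
  extend {v} refl = map⁺ (applyUpTo⁺₂ id (suc B) (λ m → trans (length-++ v) (+-comm (length v) 1)))

weightFrom-snoc : ∀ i (v : List ℕ) m → weightFrom i (v ++ (m ∷ [])) ≡ weightFrom i v + (i + length v) * m
weightFrom-snoc i []      m rewrite +-identityʳ i = +-identityʳ (i * m)
weightFrom-snoc i (x ∷ v) m = begin
  i * x + weightFrom (suc i) (v ++ (m ∷ []))            ≡⟨ cong (i * x +_) (weightFrom-snoc (suc i) v m) ⟩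
  i * x + (weightFrom (suc i) v + (suc i + length v) * m) ≡⟨ sym (+-assoc (i * x) _ _) ⟩
  i * x + weightFrom (suc i) v + (suc i + length v) * m   ≡⟨ cong (λ j → i * x + weightFrom (suc i) v + j * m) (sym (+-suc i (length v))) ⟩
  i * x + weightFrom (suc i) v + (i + suc (length v)) * m ∎
  where
  open ≡-Reasoning

Tally-peel : ∀ B k g → Tally B (suc k) g ≡ Tally B k (λ w → Σ-prog g (suc k) w (suc B))
Tally-peel B k g = begin
  sum (map (g ∘ weight) (concatMap extensions (MultVecs B k)))
    ≡⟨ sum-concatMap (g ∘ weight) extensions (MultVecs B k) ⟩
  sum (map (sum ∘ map (g ∘ weight) ∘ extensions) (MultVecs B k))
    ≡⟨ cong sum (map-cong-local (All.map extension-sum (MultVecs-length B k))) ⟩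
  Tally B k (λ w → Σ-prog g (suc k) w (suc B)) ∎
  where
  open ≡-Reasoning
  extensions : List ℕ → List (List ℕ)
  extensions v = map (λ m → v ++ (m ∷ [])) (upTo (suc B))
  extension-sum : ∀ {v} → length v ≡ k →
    sum (map (g ∘ weight) (extensions v)) ≡ Σ-prog g (suc k) (weight v) (suc B)
  extension-sum {v} refl = begin
    sum (map (g ∘ weight) (map (λ m → v ++ (m ∷ [])) (upTo (suc B))))
      ≡⟨ cong (sum ∘ map (g ∘ weight)) (map-applyUpTo id (λ m → v ++ (m ∷ [])) (suc B)) ⟩
    sum (map (g ∘ weight) (applyUpTo (λ m → v ++ (m ∷ [])) (suc B)))
      ≡⟨ cong sum (map-applyUpTo (λ m → v ++ (m ∷ [])) (g ∘ weight) (suc B)) ⟩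
    Σ< (λ m → g (weight (v ++ (m ∷ [])))) (suc B)
      ≡⟨ Σ<-cong (suc B) (λ m → cong g (weightFrom-snoc 1 v m)) ⟩
    Σ-prog g (suc k) (weight v) (suc B) ∎

-- If g vanishes above n, the bound B on the multiplicities does not matter
-- as soon as B ≥ n: no vector with an entry > n has weight ≤ n.
Tally-bound : ∀ k {g n} → (∀ w → n < w → g w ≡ 0) → ∀ B → n ≤ B → Tally B k g ≡ Tally n k g
Tally-bound zero    g-above B n≤B = refl
Tally-bound (suc k) {g} {n} g-above B n≤B = begin
  Tally B (suc k) g                                 ≡⟨ Tally-peel B k g ⟩
  Tally B k (λ w → Σ-prog g (suc k) w (suc B))      ≡⟨ Tally-cong B k (λ w → Σ-prog-truncate g-above k w B n≤B) ⟩
  Tally B k (λ w → Σ-prog g (suc k) w (suc n))      ≡⟨ Tally-bound k (Σ-prog-above g-above k (suc n)) B n≤B ⟩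
  Tally n k (λ w → Σ-prog g (suc k) w (suc n))      ≡⟨ sym (Tally-peel n k g) ⟩
  Tally n (suc k) g                                 ∎
  where open ≡-Reasoning

p-rec : ∀ k n → p (suc k + n) (suc k) ≡ p (suc k + n) k + p n (suc k)
p-rec k n = begin
  p N K                                                ≡⟨ p≡Tally N K ⟩
  Tally N K (δ N)                                      ≡⟨ Tally-peel N k (δ N) ⟩
  Tally N k (λ w → Σ-prog (δ N) K w (suc N))           ≡⟨ Tally-cong N k split-first ⟩
  Tally N k (λ w → δ N w + Σ-prog (δ n) K w N)         ≡⟨ sum-map-+ (δ N ∘ weight) _ (MultVecs N k) ⟩
  Tally N k (δ N) + Tally N k (λ w → Σ-prog (δ n) K w N)
    ≡⟨ cong₂ _+_ (sym (p≡Tally N k)) (Tally-cong N k (λ w → Σ-prog-truncate (δ-above n) k w (k + n) (m≤n+m n k))) ⟩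
  p N k + Tally N k (λ w → Σ-prog (δ n) K w (suc n))
    ≡⟨ cong (p N k +_) (Tally-bound k (Σ-prog-above (δ-above n) k (suc n)) N n≤N) ⟩
  p N k + Tally n k (λ w → Σ-prog (δ n) K w (suc n))   ≡⟨ cong (p N k +_) (sym (Tally-peel n k (δ n))) ⟩
  p N k + Tally n K (δ n)                              ≡⟨ cong (p N k +_) (sym (p≡Tally n K)) ⟩
  p N k + p n K                                        ∎
  where
  open ≡-Reasoning
  K N : ℕ
  K = suc k
  N = K + n
  n≤N : n ≤ N
  n≤N = m≤n+m n K
  -- The term m = 0 of the progression is δ N w; the terms m + 1 are
  -- δ N (K + (w + K m)) = δ n (w + K m).
  split-first : ∀ w → Σ-prog (δ N) K w (suc N) ≡ δ N w + Σ-prog (δ n) K w N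
  split-first w = cong₂ _+_
    (cong (δ N) (trans (cong (w +_) (*-zeroʳ K)) (+-identityʳ w)))
    (Σ<-cong N (λ m → trans (cong (δ N) (step-eq K w m)) (δ-shift K n (w + K * m))))
    where
    step-eq : ∀ a x m → x + a * suc m ≡ a + (x + a * m)
    step-eq = solve-∀

p-one : ∀ n → p n 1 ≡ 1
p-one zero    = refl
p-one (suc n) = trans (p-rec 0 n) (p-one n)

Tri : ℕ → ℕ
Tri j = (j * (j + 1)) / 2

Tri-suc : ∀ j → Tri (suc j) ≡ suc j + Tri j
Tri-suc j = begin
  (suc j * (suc j + 1)) / 2           ≡⟨ cong (_/ 2) (expand j) ⟩
  (suc j * 2 + j * (j + 1)) / 2       ≡⟨ +-distrib-/-∣ˡ (j * (j + 1)) (divides (suc j) refl) ⟩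
  (suc j * 2) / 2 + Tri j             ≡⟨ cong (_+ Tri j) (m*n/n≡m (suc j) 2) ⟩
  suc j + Tri j                       ∎
  where
  open ≡-Reasoning
  expand : ∀ j → suc j * (suc j + 1) ≡ suc j * 2 + j * (j + 1)
  expand = solve-∀

EvenRun : ℕ → ℕ → ℕ → Set
EvenRun K s L = ∀ i → i < L → 2 ∣ p (s + i) K

-- Parity descent: an even run of length K + L for parts ≤ K = k + 1 yields
-- an even run of length L for parts ≤ k, starting K later, because
-- p(K + n, k) = p(K + n, K) - p(n, K) by the recurrence.
EvenRun-descend : ∀ k s L → EvenRun (suc k) s (suc k + L) → EvenRun k (s + suc k) L
EvenRun-descend k s L run i i<L = subst (λ j → 2 ∣ p j k) (sym shifted) (∣m+n∣m⇒∣n sum-even (run i i<K+L))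
  where
  K : ℕ
  K = suc k
  shifted : s + K + i ≡ K + (s + i)
  shifted = trans (cong (_+ i) (+-comm s K)) (+-assoc K s i)
  i<K+L : i < K + L
  i<K+L = <-≤-trans i<L (m≤n+m L K)
  top-even : 2 ∣ p (K + (s + i)) K
  top-even = subst (λ j → 2 ∣ p j K) (trans (sym (+-assoc s K i)) shifted) (run (K + i) (+-monoʳ-< K i<L))
  sum-even : 2 ∣ p (s + i) K + p (K + (s + i)) k
  sum-even = subst (2 ∣_) (trans (p-rec k (s + i)) (+-comm (p (K + (s + i)) k) (p (s + i) K))) top-even

¬2∣1 : ¬ (2 ∣ 1)
¬2∣1 (divides zero    ())
¬2∣1 (divides (suc q) ())

no-even-run : ∀ k s → ¬ EvenRun (suc k) s (Tri (suc k))
no-even-run zero    s run = ¬2∣1 (subst (2 ∣_) (trans (cong (λ j → p j 1) (+-identityʳ s)) (p-one s)) (run 0 (s≤s z≤n)))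
no-even-run (suc k) s run =
  no-even-run k (s + suc (suc k))
    (EvenRun-descend (suc k) s (Tri (suc k)) (subst (EvenRun (suc (suc k)) s) (Tri-suc (suc k)) run))

theorem4p1 : (k : ℕ) → 0 < k →
    ¬ (∃[ s ] ((i : ℕ) → i < (k * (k + 1)) / 2 → 2 ∣ p (s + i) k))
theorem4p1 (suc k) _ (s , run) = no-even-run k s run
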